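{- Let $d,k,s$ be integers such that $d\ge (s+k)/2+1$ and $d\ge k+1$. Let $G'$ be a bipartite graph with parts $S$ and $U$, where $|S|=s$ and $|U|=s+1$. Suppose that every vertex of $U$ has degree at least $d$ in $G'$, that every vertex of $S$ has degree at most $d+2$ in $G'$, and that at most one vertex of $S$ has degree exactly $d+2$. Then for every subset $S'\subset S$ with $|S'|=k$ and every subset $U'\subset U$ with $|U'|=k+1$, the graph $G'-S'-U'$ (obtained by deleting the vertices of $S'\cup U'$) has a perfect matching.
   Context: All graphs are finite, simple, and undirected. -}

module Defs where

open import Data.Nat using (ℕ; zero; suc; _+_)
open import Data.Bool using (Bool; true; false)
open import Data.Fin using (Fin; zero; suc)
open import Data.Fin.Subset using (Subset; _∉_)
open import Data.Product using (_×_)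
open import Relation.Binary.PropositionalEquality using (_≡_)

count : ∀ {n} → (Fin n → Bool) → ℕ
count {zero}  f = 0
count {suc n} f with f zero
... | true  = suc (count (λ i → f (suc i)))
... | false = count (λ i → f (suc i))

BipGraph : ℕ → ℕ → Set
BipGraph s t = Fin s → Fin t → Bool

degS : ∀ {s t} → BipGraph s t → Fin s → ℕ
degS G i = count (G i)

degU : ∀ {s t} → BipGraph s t → Fin t → ℕ
degU G u = count (λ i → G i u)

IsPerfectMatchingDel : ∀ {s t} → BipGraph s t → Subset s → Subset t → BipGraph s t → Set
IsPerfectMatchingDel {s} {t} G S' U' M =
  (∀ i u → M i u ≡ true → (G i u ≡ true) × (i ∉ S') × (u ∉ U'))
  × (∀ i → i ∉ S' → degS M i ≡ 1)
  × (∀ u → u ∉ U' → degU M u ≡ 1)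

-- Write P = S ∖ S' and Q = U ∖ U'; both have s - k vertices.  The proof is
-- Hall's marriage theorem plus a double-counting argument.
--
--  * Subsets of Fin n are Bool-valued functions; we first develop counting
--    (via the library's finite sums ∑) and the handshake identity
--    ∑ deg_S = ∑ deg_U for a bipartite graph.
--  * Hall's theorem is proved for an arbitrary biadjacency relation by the
--    Halmos–Vaughan induction: either some proper nonempty X ⊆ P is critical
--    (|N(X) ∩ Q| ≤ |X|) and the problem splits along X, or no set is
--    critical and any edge ab can be matched first.  A matching saturating P
--    with |P| = |Q| also saturates Q.
--  * Hall's condition for P, Q: if |N(X) ∩ Q| < |X| then some u ∈ Q has no
--    neighbour in X, so |S ∖ X| ≥ d.  Bounding ∑ deg_S from above (vertices
--    of X have degree ≤ |N(X)| ≤ |N(X) ∩ Q| + k + 1, the others ≤ d + 1 save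
--    one vertex of degree d + 2) and from below by (s + 1) d contradicts
--    s + k + 2 ≤ 2d.
module Submission where

open import Defs
open import Data.Nat using (ℕ; zero; suc; _+_; _*_; _≤_; _<_; z≤n; s≤s; _≤?_)
open import Data.Nat.Properties
open import Data.Nat.Induction using (Acc; acc; <-wellFounded)
open import Data.Nat.Tactic.RingSolver using (solve-∀)
open import Data.Bool using (Bool; true; false; not; _∧_; _∨_; if_then_else_)
open import Data.Bool.Properties using (∧-conicalˡ; ∧-conicalʳ; ∧-comm; ∧-assoc; ∨-identityʳ; not-involutive)
  renaming (_≟_ to _≟ᵇ_)
open import Data.Fin using (Fin; zero; suc)
open import Data.Fin.Properties using (all?) renaming (_≟_ to _≟ᶠ_)
open import Data.Fin.Subset using (Subset; ∣_∣; _∉_)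
open import Data.Fin.Subset.Properties using (anySubset?)
open import Data.Vec using ([]; _∷_; lookup; tabulate)
open import Data.Vec.Properties using ([]=⇒lookup; lookup⇒[]=; lookup∘tabulate)
open import Data.Product using (Σ; ∃; _×_; _,_; proj₁; proj₂)
open import Data.Sum using (_⊎_; inj₁; inj₂)
open import Data.Empty using (⊥; ⊥-elim)
open import Relation.Nullary using (¬_; Dec; yes; no; does)
open import Relation.Nullary.Decidable using (_×-dec_; _→-dec_; dec-true; dec-false)
open import Relation.Binary.PropositionalEquality
open import Algebra.Properties.Semiring.Sum +-*-semiring
  using (sum; sum-cong-≗; ∑-distrib-+; ∑-comm; sum-syntax)
open import Algebra.Properties.CommutativeSemigroup +-commutativeSemigroup using (x∙yz≈y∙xz)

Sub : ℕ → Set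
Sub n = Fin n → Bool

infix  4 _⊆_
infixr 7 _∩_
infixr 6 _∪_ _∖_

_⊆_ : ∀ {n} → Sub n → Sub n → Set
X ⊆ Y = ∀ i → X i ≡ true → Y i ≡ true

_∩_ _∪_ _∖_ : ∀ {n} → Sub n → Sub n → Sub n
(X ∩ Y) i = X i ∧ Y i
(X ∪ Y) i = X i ∨ Y i
(X ∖ Y) i = X i ∧ not (Y i)

∁ : ∀ {n} → Sub n → Sub n
∁ X i = not (X i)

⁅_⁆ : ∀ {n} → Fin n → Sub n
⁅ a ⁆ i = does (i ≟ᶠ a)

Disjoint : ∀ {n} → Sub n → Sub n → Set
Disjoint X Y = ∀ i → X i ≡ true → Y i ≡ true → ⊥

false≢true : false ≡ true → ⊥
false≢true ()

¬true⇒false : ∀ {b} → ¬ (b ≡ true) → b ≡ false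
¬true⇒false {false} _ = refl
¬true⇒false {true}  h = ⊥-elim (h refl)

∩-⊆ˡ : ∀ {n} (X Y : Sub n) → X ∩ Y ⊆ X
∩-⊆ˡ X Y i = ∧-conicalˡ (X i) (Y i)

∩-⊆ʳ : ∀ {n} (X Y : Sub n) → X ∩ Y ⊆ Y
∩-⊆ʳ X Y i = ∧-conicalʳ (X i) (Y i)

∩-intro : ∀ {n} (X Y : Sub n) i → X i ≡ true → Y i ≡ true → (X ∩ Y) i ≡ true
∩-intro X Y i x y rewrite x | y = refl

∪-elim : ∀ {n} (X Y : Sub n) i → (X ∪ Y) i ≡ true → X i ≡ true ⊎ Y i ≡ true
∪-elim X Y i h with X i
... | true  = inj₁ refl
... | false = inj₂ h

∁-elim : ∀ {n} (X : Sub n) i → ∁ X i ≡ true → X i ≡ true → ⊥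
∁-elim X i h x = false≢true (trans (sym (cong not x)) h)

∁-intro : ∀ {n} (X : Sub n) i → ¬ (X i ≡ true) → ∁ X i ≡ true
∁-intro X i h = cong not (¬true⇒false h)

does-true : ∀ {A : Set} (a? : Dec A) → does a? ≡ true → A
does-true (yes a) _ = a

⁅⁆-self : ∀ {n} (a : Fin n) → ⁅ a ⁆ a ≡ true
⁅⁆-self a = dec-true (a ≟ᶠ a) refl

⁅⁆-elim : ∀ {n} {a : Fin n} i → ⁅ a ⁆ i ≡ true → i ≡ a
⁅⁆-elim {a = a} i = does-true (i ≟ᶠ a)

⁅⁆-⊆ : ∀ {n} {X : Sub n} {a} → X a ≡ true → ⁅ a ⁆ ⊆ X
⁅⁆-⊆ {X = X} xa j j≡a = subst (λ z → X z ≡ true) (sym (⁅⁆-elim j j≡a)) xa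

∖-disjoint : ∀ {n} {X Y Z : Sub n} → X ⊆ Z → Disjoint X (Y ∖ Z)
∖-disjoint {Y = Y} {Z} X⊆Z i x y = ∁-elim Z i (∩-⊆ʳ Y (∁ Z) i y) (X⊆Z i x)

indicator : Bool → ℕ
indicator true  = 1
indicator false = 0

∑-mono : ∀ {n} {f g : Fin n → ℕ} → (∀ i → f i ≤ g i) → sum f ≤ sum g
∑-mono {zero}  _   = z≤n
∑-mono {suc n} f≤g = +-mono-≤ (f≤g zero) (∑-mono (λ i → f≤g (suc i)))

∑-const : ∀ n c → ∑[ i < n ] c ≡ n * c
∑-const zero    c = refl
∑-const (suc n) c = cong (c +_) (∑-const n c)

+-tight : ∀ {a b c d} → a ≤ c → b ≤ d → c + d ≤ a + b → c ≤ a × d ≤ b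
+-tight {a} {b} {c} {d} a≤c b≤d c+d≤a+b =
  +-cancelʳ-≤ d c a (≤-trans c+d≤a+b (+-monoʳ-≤ a b≤d)) ,
  +-cancelˡ-≤ c d b (≤-trans c+d≤a+b (+-monoˡ-≤ b a≤c))

∑-tight : ∀ {n} {f g : Fin n → ℕ} → (∀ i → f i ≤ g i) → sum g ≤ sum f → ∀ i → f i ≡ g i
∑-tight {suc n} f≤g ∑g≤∑f zero =
  ≤-antisym (f≤g zero) (proj₁ (+-tight (f≤g zero) (∑-mono (λ j → f≤g (suc j))) ∑g≤∑f))
∑-tight {suc n} f≤g ∑g≤∑f (suc i) =
  ∑-tight (λ j → f≤g (suc j)) (proj₂ (+-tight (f≤g zero) (∑-mono (λ j → f≤g (suc j))) ∑g≤∑f)) i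

∑-if : ∀ {n} (X : Sub n) a b → ∑[ i < n ] (if X i then a else b) ≡ count X * a + count (∁ X) * b
∑-if {zero}  X a b = refl
∑-if {suc n} X a b with X zero
... | true  = trans (cong (a +_) (∑-if (λ i → X (suc i)) a b)) (sym (+-assoc a _ _))
... | false = trans (cong (b +_) (∑-if (λ i → X (suc i)) a b))
                    (x∙yz≈y∙xz b (count (λ i → X (suc i)) * a) (count (λ i → not (X (suc i))) * b))

count≡∑ : ∀ {n} (X : Sub n) → count X ≡ ∑[ i < n ] indicator (X i)
count≡∑ {zero}  X = refl
count≡∑ {suc n} X with X zero
... | true  = cong suc (count≡∑ (λ i → X (suc i)))
... | false = count≡∑ (λ i → X (suc i))

count-cong : ∀ {n} {X Y : Sub n} → (∀ i → X i ≡ Y i) → count X ≡ count Y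
count-cong {X = X} {Y} X≗Y = begin
  count X                      ≡⟨ count≡∑ X ⟩
  sum (λ i → indicator (X i))  ≡⟨ sum-cong-≗ (λ i → cong indicator (X≗Y i)) ⟩
  sum (λ i → indicator (Y i))  ≡⟨ count≡∑ Y ⟨
  count Y                      ∎
  where open ≡-Reasoning

count-mono : ∀ {n} {X Y : Sub n} → X ⊆ Y → count X ≤ count Y
count-mono {X = X} {Y} X⊆Y = subst₂ _≤_ (sym (count≡∑ X)) (sym (count≡∑ Y))
  (∑-mono λ i → indicator-mono (X i) (Y i) (X⊆Y i))
  where
  indicator-mono : ∀ a b → (a ≡ true → b ≡ true) → indicator a ≤ indicator b
  indicator-mono false b _ = z≤n
  indicator-mono true  b h rewrite h refl = ≤-refl

count-split : ∀ {n} (X Y : Sub n) → count X ≡ count (X ∩ Y) + count (X ∖ Y)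
count-split {n} X Y = begin
  count X                                                     ≡⟨ count≡∑ X ⟩
  sum (λ i → indicator (X i))                                 ≡⟨ sum-cong-≗ (λ i → split (X i) (Y i)) ⟩
  sum (λ i → indicator ((X ∩ Y) i) + indicator ((X ∖ Y) i))   ≡⟨ ∑-distrib-+ {n} _ _ ⟩
  sum (λ i → indicator ((X ∩ Y) i)) + sum (λ i → indicator ((X ∖ Y) i))
                                                              ≡⟨ cong₂ _+_ (count≡∑ (X ∩ Y)) (count≡∑ (X ∖ Y)) ⟨
  count (X ∩ Y) + count (X ∖ Y)                               ∎
  where
  open ≡-Reasoning
  split : ∀ a b → indicator a ≡ indicator (a ∧ b) + indicator (a ∧ not b)
  split false _     = refl
  split true  true  = refl
  split true  false = refl

count-∅ : ∀ {n} → count {n} (λ _ → false) ≡ 0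
count-∅ {zero}  = refl
count-∅ {suc n} = count-∅ {n}

count-full : ∀ {n} → count {n} (λ _ → true) ≡ n
count-full {zero}  = refl
count-full {suc n} = cong suc (count-full {n})

count-compl : ∀ {n} (X : Sub n) → count X + count (∁ X) ≡ n
count-compl X = trans (sym (count-split (λ _ → true) X)) count-full

count-⁅⁆ : ∀ {n} (a : Fin n) → count ⁅ a ⁆ ≡ 1
count-⁅⁆ {suc n} zero    = cong suc (count-∅ {n})
count-⁅⁆ {suc n} (suc a) = count-⁅⁆ a

count-witness : ∀ {n} (X : Sub n) → 1 ≤ count X → ∃ λ i → X i ≡ true
count-witness {suc n} X h with X zero in e
... | true  = zero , e
... | false with count-witness (λ i → X (suc i)) h
...   | i , x = suc i , x

count-pos : ∀ {n} (X : Sub n) i → X i ≡ true → 1 ≤ count X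
count-pos X i x = subst (_≤ count X) (count-⁅⁆ i) (count-mono (⁅⁆-⊆ {X = X} x))

count-empty : ∀ {n} (X : Sub n) → ¬ (1 ≤ count X) → ∀ i → ¬ (X i ≡ true)
count-empty X h i x = h (count-pos X i x)

count-≤1 : ∀ {n} (X : Sub n) → (∀ i j → X i ≡ true → X j ≡ true → i ≡ j) → count X ≤ 1
count-≤1 X unique with 1 ≤? count X
... | no  X=∅ = ≤-trans (≮⇒≥ X=∅) z≤n
... | yes X≠∅ with count-witness X X≠∅
...   | a , xa = subst (count X ≤_) (count-⁅⁆ a)
                   (count-mono (λ j xj → subst (λ z → ⁅ z ⁆ j ≡ true) (unique j a xj xa) (⁅⁆-self j)))

count-⊆ : ∀ {n} {X P : Sub n} → X ⊆ P → count P ≡ count X + count (P ∖ X)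
count-⊆ {X = X} {P} X⊆P = trans (count-split P X) (cong (_+ count (P ∖ X)) (count-cong P∩X≗X))
  where
  P∩X≗X : ∀ i → P i ∧ X i ≡ X i
  P∩X≗X i with X i in e
  ... | true  rewrite X⊆P i e = refl
  ... | false = ∧-comm (P i) false

count-∪ : ∀ {n} (Y X : Sub n) → Disjoint Y X → count (Y ∪ X) ≡ count Y + count X
count-∪ Y X disjoint = begin
  count (Y ∪ X)                           ≡⟨ count-split (Y ∪ X) X ⟩
  count ((Y ∪ X) ∩ X) + count ((Y ∪ X) ∖ X) ≡⟨ +-comm (count ((Y ∪ X) ∩ X)) _ ⟩
  count ((Y ∪ X) ∖ X) + count ((Y ∪ X) ∩ X) ≡⟨ cong₂ _+_ (count-cong outside) (count-cong inside) ⟩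
  count Y + count X                       ∎
  where
  open ≡-Reasoning
  outside : ∀ i → (Y i ∨ X i) ∧ not (X i) ≡ Y i
  outside i with Y i in ey | X i in ex
  ... | true  | true  = ⊥-elim (disjoint i ey ex)
  ... | true  | false = refl
  ... | false | true  = refl
  ... | false | false = refl
  inside : ∀ i → (Y i ∨ X i) ∧ X i ≡ X i
  inside i with Y i | X i
  ... | true  | true  = refl
  ... | true  | false = refl
  ... | false | true  = refl
  ... | false | false = refl

count-∪-∅ : ∀ {n} (X Y : Sub n) → (∀ i → ¬ (Y i ≡ true)) → count (X ∪ Y) ≡ count X
count-∪-∅ X Y Y=∅ = count-cong (λ i → trans (cong (X i ∨_) (¬true⇒false (Y=∅ i))) (∨-identityʳ (X i)))

count-∅-∪ : ∀ {n} (X Y : Sub n) → (∀ i → ¬ (X i ≡ true)) → count (X ∪ Y) ≡ count Y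
count-∅-∪ X Y X=∅ = count-cong (λ i → cong (_∨ Y i) (¬true⇒false (X=∅ i)))

count-∖-< : ∀ {n} {X P : Sub n} → X ⊆ P → 1 ≤ count X → count (P ∖ X) < count P
count-∖-< {X = X} {P} X⊆P X≠∅ = subst (count (P ∖ X) <_) (sym (count-⊆ X⊆P)) (+-monoˡ-≤ (count (P ∖ X)) X≠∅)

count-∖-⁅⁆ : ∀ {n} (X : Sub n) b → count X ≤ 1 + count (X ∖ ⁅ b ⁆)
count-∖-⁅⁆ X b = subst (_≤ 1 + count (X ∖ ⁅ b ⁆)) (sym (count-split X ⁅ b ⁆))
  (+-monoˡ-≤ (count (X ∖ ⁅ b ⁆)) (subst (count (X ∩ ⁅ b ⁆) ≤_) (count-⁅⁆ b) (count-mono (∩-⊆ʳ X ⁅ b ⁆))))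

handshake : ∀ {s t} (G : BipGraph s t) → ∑[ i < s ] degS G i ≡ ∑[ u < t ] degU G u
handshake {s} {t} G = begin
  ∑[ i < s ] degS G i                      ≡⟨ sum-cong-≗ (λ i → count≡∑ (G i)) ⟩
  ∑[ i < s ] ∑[ u < t ] indicator (G i u)  ≡⟨ ∑-comm (λ i u → indicator (G i u)) ⟩
  ∑[ u < t ] ∑[ i < s ] indicator (G i u)  ≡⟨ sum-cong-≗ (λ u → count≡∑ (λ i → G i u)) ⟨
  ∑[ u < t ] degU G u                      ∎
  where open ≡-Reasoning

positive : ℕ → Bool
positive zero    = false
positive (suc _) = true

positive-intro : ∀ {m} → 1 ≤ m → positive m ≡ true
positive-intro (s≤s _) = refl

positive-elim : ∀ {m} → positive m ≡ true → 1 ≤ m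
positive-elim {suc m} _ = s≤s z≤n

_⊆?_ : ∀ {n} (X Y : Sub n) → Dec (X ⊆ Y)
X ⊆? Y = all? (λ i → (X i ≟ᵇ true) →-dec (Y i ≟ᵇ true))

module Hall {n t : ℕ} (R : BipGraph n t) where

  N : Sub n → Sub t
  N X u = positive (count (λ i → X i ∧ R i u))

  N-intro : ∀ {X} i u → X i ≡ true → R i u ≡ true → N X u ≡ true
  N-intro {X} i u x r = positive-intro (count-pos (λ j → X j ∧ R j u) i (∩-intro X (λ j → R j u) i x r))

  N-elim : ∀ {X} u → N X u ≡ true → ∃ λ i → X i ≡ true × R i u ≡ true
  N-elim {X} u h with count-witness (λ j → X j ∧ R j u) (positive-elim h)
  ... | i , p = i , ∩-⊆ˡ X (λ j → R j u) i p , ∩-⊆ʳ X (λ j → R j u) i p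

  N-mono : ∀ {X Y} → X ⊆ Y → N X ⊆ N Y
  N-mono X⊆Y u h with N-elim u h
  ... | i , x , r = N-intro i u (X⊆Y i x) r

  N-cong : ∀ {X Y} → (∀ i → X i ≡ Y i) → ∀ u → N X u ≡ N Y u
  N-cong X≗Y u = cong positive (count-cong (λ i → cong (_∧ R i u) (X≗Y i)))

  N-∪ : ∀ X Y u → N (X ∪ Y) u ≡ true → N X u ≡ true ⊎ N Y u ≡ true
  N-∪ X Y u h with N-elim u h
  ... | i , xy , r with ∪-elim X Y i xy
  ...   | inj₁ x = inj₁ (N-intro i u x r)
  ...   | inj₂ y = inj₂ (N-intro i u y r)

  record IsMatching (P : Sub n) (Q : Sub t) (M : BipGraph n t) : Set where
    field
      edge   : ∀ i u → M i u ≡ true → R i u ≡ true × P i ≡ true × Q u ≡ true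
      row    : ∀ i → P i ≡ true → count (M i) ≡ 1
      column : ∀ u → count (λ i → M i u) ≤ 1

  Matching : Sub n → Sub t → Set
  Matching P Q = Σ (BipGraph n t) (IsMatching P Q)

  empty-matching : ∀ {P Q} → (∀ i → ¬ (P i ≡ true)) → Matching P Q
  empty-matching P=∅ = (λ _ _ → false) , record
    { edge   = λ _ _ ()
    ; row    = λ i Pi → ⊥-elim (P=∅ i Pi)
    ; column = λ _ → ≤-trans (≤-reflexive (count-∅ {n})) z≤n }

  edge-matching : ∀ {a b} → R a b ≡ true → Matching ⁅ a ⁆ ⁅ b ⁆
  edge-matching {a} {b} Rab = (λ i u → ⁅ a ⁆ i ∧ ⁅ b ⁆ u) , record
    { edge   = edge
    ; row    = row
    ; column = λ u → subst (count (λ i → ⁅ a ⁆ i ∧ ⁅ b ⁆ u) ≤_) (count-⁅⁆ a) (count-mono (∩-⊆ˡ ⁅ a ⁆ (λ _ → ⁅ b ⁆ u))) }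
    where
    edge : ∀ i u → ⁅ a ⁆ i ∧ ⁅ b ⁆ u ≡ true → R i u ≡ true × ⁅ a ⁆ i ≡ true × ⁅ b ⁆ u ≡ true
    edge i u h = subst₂ (λ x y → R x y ≡ true) (sym (⁅⁆-elim i i∈a)) (sym (⁅⁆-elim u u∈b)) Rab , i∈a , u∈b
      where
      i∈a : ⁅ a ⁆ i ≡ true
      i∈a = ∧-conicalˡ (⁅ a ⁆ i) _ h
      u∈b : ⁅ b ⁆ u ≡ true
      u∈b = ∧-conicalʳ (⁅ a ⁆ i) _ h
    row : ∀ i → ⁅ a ⁆ i ≡ true → count (λ u → ⁅ a ⁆ i ∧ ⁅ b ⁆ u) ≡ 1
    row i i∈a rewrite i∈a = count-⁅⁆ b

  matching-split : ∀ {P P₁ Q Q₁ Q₂} → P₁ ⊆ P → Q₁ ⊆ Q → Q₂ ⊆ Q → Disjoint Q₁ Q₂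
    → Matching P₁ Q₁ → Matching (P ∖ P₁) Q₂ → Matching P Q
  matching-split {P} {P₁} {Q} {Q₁} {Q₂} P₁⊆P Q₁⊆Q Q₂⊆Q Q₁#Q₂ (M₁ , m₁) (M₂ , m₂) =
    (λ i u → M₁ i u ∨ M₂ i u) , record { edge = edge ; row = row ; column = column }
    where
    module m₁ = IsMatching m₁
    module m₂ = IsMatching m₂

    edge : ∀ i u → M₁ i u ∨ M₂ i u ≡ true → R i u ≡ true × P i ≡ true × Q u ≡ true
    edge i u h with ∪-elim (M₁ i) (M₂ i) u h
    ... | inj₁ m with m₁.edge i u m
    ...   | r , p , q = r , P₁⊆P i p , Q₁⊆Q u q
    edge i u h | inj₂ m with m₂.edge i u m
    ...   | r , p , q = r , ∩-⊆ˡ P (∁ P₁) i p , Q₂⊆Q u q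

    row : ∀ i → P i ≡ true → count (λ u → M₁ i u ∨ M₂ i u) ≡ 1
    row i Pi with P₁ i in e
    ... | true  = trans (count-∪-∅ (M₁ i) (M₂ i) (λ u m → ∁-elim P₁ i (∩-⊆ʳ P (∁ P₁) i (proj₁ (proj₂ (m₂.edge i u m)))) e))
                        (m₁.row i e)
    ... | false = trans (count-∅-∪ (M₁ i) (M₂ i) (λ u m → false≢true (trans (sym e) (proj₁ (proj₂ (m₁.edge i u m))))))
                        (m₂.row i (∩-intro P (∁ P₁) i Pi (cong not e)))

    column : ∀ u → count (λ i → M₁ i u ∨ M₂ i u) ≤ 1
    column u with Q₁ u in e
    ... | true  = subst (_≤ 1) (sym (count-∪-∅ (λ i → M₁ i u) (λ i → M₂ i u)
                    (λ i m → Q₁#Q₂ u e (proj₂ (proj₂ (m₂.edge i u m)))))) (m₁.column u)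
    ... | false = subst (_≤ 1) (sym (count-∅-∪ (λ i → M₁ i u) (λ i → M₂ i u)
                    (λ i m → false≢true (trans (sym e) (proj₂ (proj₂ (m₁.edge i u m))))))) (m₂.column u)

  matching-perfect : ∀ {P Q M} → IsMatching P Q M → count P ≡ count Q
    → ∀ u → Q u ≡ true → degU M u ≡ 1
  matching-perfect {P} {Q} {M} m |P|≡|Q| u Qu = trans (∑-tight column≤ ∑Q≤∑columns u) (cong indicator Qu)
    where
    open IsMatching m
    open ≤-Reasoning
    column≤ : ∀ u → degU M u ≤ indicator (Q u)
    column≤ u with Q u in e
    ... | true  = column u
    ... | false = ≤-reflexive (trans (count-cong (λ i → ¬true⇒false
                    (λ h → false≢true (trans (sym e) (proj₂ (proj₂ (edge i u h))))))) (count-∅ {n}))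
    row≡ : ∀ i → degS M i ≡ indicator (P i)
    row≡ i with P i in e
    ... | true  = row i e
    ... | false = trans (count-cong (λ u → ¬true⇒false
                    (λ h → false≢true (trans (sym e) (proj₁ (proj₂ (edge i u h))))))) (count-∅ {t})
    ∑Q≤∑columns : ∑[ u < t ] indicator (Q u) ≤ ∑[ u < t ] degU M u
    ∑Q≤∑columns = begin
      ∑[ u < t ] indicator (Q u)  ≡⟨ count≡∑ Q ⟨
      count Q                     ≡⟨ |P|≡|Q| ⟨
      count P                     ≡⟨ count≡∑ P ⟩
      ∑[ i < n ] indicator (P i)  ≡⟨ sum-cong-≗ row≡ ⟨
      ∑[ i < n ] degS M i         ≡⟨ handshake M ⟩
      ∑[ u < t ] degU M u         ∎

  HallCondition : Sub n → Sub t → Set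
  HallCondition P Q = ∀ X → X ⊆ P → count X ≤ count (N X ∩ Q)

  Critical : Sub n → Sub t → Sub n → Set
  Critical P Q X = X ⊆ P × 1 ≤ count X × count X < count P × count (N X ∩ Q) ≤ count X

  critical? : ∀ P Q X → Dec (Critical P Q X)
  critical? P Q X = (X ⊆? P) ×-dec (1 ≤? count X) ×-dec (suc (count X) ≤? count P) ×-dec (count (N X ∩ Q) ≤? count X)

  critical-cong : ∀ {P Q X Y} → (∀ i → X i ≡ Y i) → Critical P Q X → Critical P Q Y
  critical-cong {P} {Q} {X} {Y} X≗Y (X⊆P , X≠∅ , X<P , tight) =
    (λ i y → X⊆P i (trans (X≗Y i) y)) ,
    subst (1 ≤_) |X|≡|Y| X≠∅ ,
    subst (_< count P) |X|≡|Y| X<P ,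
    subst₂ _≤_ (count-cong (λ u → cong (_∧ Q u) (N-cong X≗Y u))) |X|≡|Y| tight
    where
    |X|≡|Y| : count X ≡ count Y
    |X|≡|Y| = count-cong X≗Y

  find-critical : ∀ P Q → (∃ λ X → Critical P Q X) ⊎ (∀ X → ¬ Critical P Q X)
  find-critical P Q with anySubset? (λ p → critical? P Q (lookup p))
  ... | yes (p , c) = inj₁ (lookup p , c)
  ... | no none     = inj₂ (λ X c → none (tabulate X , critical-cong (λ i → sym (lookup∘tabulate X i)) c))

  hall-inside : ∀ {P Q X} → HallCondition P Q → X ⊆ P → HallCondition X (Q ∩ N X)
  hall-inside {P} {Q} {X} hc X⊆P Y Y⊆X = ≤-trans (hc Y (λ i y → X⊆P i (Y⊆X i y))) (count-mono into)
    where
    into : N Y ∩ Q ⊆ N Y ∩ (Q ∩ N X)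
    into u h = ∩-intro (N Y) (Q ∩ N X) u (∩-⊆ˡ (N Y) Q u h)
                 (∩-intro Q (N X) u (∩-⊆ʳ (N Y) Q u h) (N-mono Y⊆X u (∩-⊆ˡ (N Y) Q u h)))

  -- If X ⊆ P is critical, Hall's condition holds for P ∖ X against Q ∖ N(X):
  -- |X| + |Y| = |Y ∪ X| ≤ |N(Y ∪ X) ∩ Q| ≤ |N(X) ∩ Q| + |N(Y) ∩ (Q ∖ N(X))|.
  hall-outside : ∀ {P Q X} → HallCondition P Q → X ⊆ P → count (N X ∩ Q) ≤ count X
    → HallCondition (P ∖ X) (Q ∖ N X)
  hall-outside {P} {Q} {X} hc X⊆P tight Y Y⊆P∖X = +-cancelˡ-≤ (count X) _ _ (begin
    count X + count Y                        ≡⟨ +-comm (count X) (count Y) ⟩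
    count Y + count X                        ≡⟨ count-∪ Y X Y#X ⟨
    count (Y ∪ X)                            ≤⟨ hc (Y ∪ X) Y∪X⊆P ⟩
    count (N (Y ∪ X) ∩ Q)                    ≡⟨ count-split (N (Y ∪ X) ∩ Q) (N X) ⟩
    count ((N (Y ∪ X) ∩ Q) ∩ N X) + count ((N (Y ∪ X) ∩ Q) ∖ N X)
                                             ≤⟨ +-mono-≤ (≤-trans (count-mono near) tight) (count-mono far) ⟩
    count X + count (N Y ∩ (Q ∖ N X))        ∎)
    where
    open ≤-Reasoning
    Y⊆P : Y ⊆ P
    Y⊆P i y = ∩-⊆ˡ P (∁ X) i (Y⊆P∖X i y)
    Y#X : Disjoint Y X
    Y#X i y x = ∁-elim X i (∩-⊆ʳ P (∁ X) i (Y⊆P∖X i y)) x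
    Y∪X⊆P : Y ∪ X ⊆ P
    Y∪X⊆P i h with ∪-elim Y X i h
    ... | inj₁ y = Y⊆P i y
    ... | inj₂ x = X⊆P i x
    near : (N (Y ∪ X) ∩ Q) ∩ N X ⊆ N X ∩ Q
    near u h = ∩-intro (N X) Q u (∩-⊆ʳ (N (Y ∪ X) ∩ Q) (N X) u h)
                 (∩-⊆ʳ (N (Y ∪ X)) Q u (∩-⊆ˡ (N (Y ∪ X) ∩ Q) (N X) u h))
    far : (N (Y ∪ X) ∩ Q) ∖ N X ⊆ N Y ∩ (Q ∖ N X)
    far u h with ∩-⊆ˡ (N (Y ∪ X) ∩ Q) (∁ (N X)) u h | ∩-⊆ʳ (N (Y ∪ X) ∩ Q) (∁ (N X)) u h
    ... | yx∩q | u∉NX with N-∪ Y X u (∩-⊆ˡ (N (Y ∪ X)) Q u yx∩q)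
    ...   | inj₁ u∈NY = ∩-intro (N Y) (Q ∖ N X) u u∈NY (∩-intro Q (∁ (N X)) u (∩-⊆ʳ (N (Y ∪ X)) Q u yx∩q) u∉NX)
    ...   | inj₂ u∈NX = ⊥-elim (∁-elim (N X) u u∉NX u∈NX)

  -- Without critical sets every nonempty proper Y ⊆ P has more than |Y|
  -- neighbours, so deleting a ∈ P and any b keeps Hall's condition.
  hall-delete : ∀ {P Q a b} → HallCondition P Q → (∀ X → ¬ Critical P Q X) → P a ≡ true
    → HallCondition (P ∖ ⁅ a ⁆) (Q ∖ ⁅ b ⁆)
  hall-delete {P} {Q} {a} {b} hc none Pa Y Y⊆P∖a with 1 ≤? count Y
  ... | no  Y=∅ = ≤-trans (≮⇒≥ Y=∅) z≤n
  ... | yes Y≠∅ = ≤-pred (begin-strict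
    count Y                             <⟨ expanding ⟩
    count (N Y ∩ Q)                     ≤⟨ count-∖-⁅⁆ (N Y ∩ Q) b ⟩
    1 + count ((N Y ∩ Q) ∖ ⁅ b ⁆)       ≡⟨ cong (1 +_) (count-cong (λ u → ∧-assoc (N Y u) (Q u) _)) ⟩
    1 + count (N Y ∩ (Q ∖ ⁅ b ⁆))       ∎)
    where
    open ≤-Reasoning
    Y⊆P : Y ⊆ P
    Y⊆P i y = ∩-⊆ˡ P (∁ ⁅ a ⁆) i (Y⊆P∖a i y)
    Y<P : count Y < count P
    Y<P = ≤-<-trans (count-mono Y⊆P∖a) (count-∖-< (⁅⁆-⊆ {X = P} Pa) (≤-reflexive (sym (count-⁅⁆ a))))
    expanding : count Y < count (N Y ∩ Q)
    expanding = ≰⇒> (λ tight → none Y (Y⊆P , Y≠∅ , Y<P , tight))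

  hall-neighbour : ∀ {P Q a} → HallCondition P Q → P a ≡ true → ∃ λ b → Q b ≡ true × R a b ≡ true
  hall-neighbour {P} {Q} {a} hc Pa
    with count-witness (N ⁅ a ⁆ ∩ Q) (subst (_≤ count (N ⁅ a ⁆ ∩ Q)) (count-⁅⁆ a) (hc ⁅ a ⁆ (⁅⁆-⊆ {X = P} Pa)))
  ... | b , h with N-elim b (∩-⊆ˡ (N ⁅ a ⁆) Q b h)
  ...   | i , i∈a , Rib = b , ∩-⊆ʳ (N ⁅ a ⁆) Q b h , subst (λ z → R z b ≡ true) (⁅⁆-elim i i∈a) Rib

  hall-acc : ∀ P Q → Acc _<_ (count P) → HallCondition P Q → Matching P Q
  hall-acc P Q (acc smaller) hc with find-critical P Q
  ... | inj₁ (X , X⊆P , X≠∅ , X<P , tight) =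
    matching-split X⊆P (∩-⊆ˡ Q (N X)) (∩-⊆ˡ Q (∁ (N X))) (∖-disjoint (∩-⊆ʳ Q (N X)))
      (hall-acc X (Q ∩ N X) (smaller X<P) (hall-inside hc X⊆P))
      (hall-acc (P ∖ X) (Q ∖ N X) (smaller (count-∖-< X⊆P X≠∅)) (hall-outside hc X⊆P tight))
  ... | inj₂ none with 1 ≤? count P
  ...   | no  P=∅ = empty-matching (count-empty P P=∅)
  ...   | yes P≠∅ with count-witness P P≠∅
  ...     | a , Pa with hall-neighbour hc Pa
  ...       | b , Qb , Rab =
    matching-split (⁅⁆-⊆ {X = P} Pa) (⁅⁆-⊆ {X = Q} Qb) (∩-⊆ˡ Q (∁ ⁅ b ⁆)) (∖-disjoint (λ _ u∈b → u∈b))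
      (edge-matching Rab)
      (hall-acc (P ∖ ⁅ a ⁆) (Q ∖ ⁅ b ⁆) (smaller (count-∖-< (⁅⁆-⊆ {X = P} Pa) (≤-reflexive (sym (count-⁅⁆ a)))))
        (hall-delete hc none Pa))

  hall : ∀ P Q → HallCondition P Q → Matching P Q
  hall P Q = hall-acc P Q (<-wellFounded (count P))

solve-for-d : ∀ d p f k e → suc p + (d + f) + k + 2 + e ≡ 2 * d → d ≡ p + f + k + 3 + e
solve-for-d d p f k e eq = sym (+-cancelˡ-≡ d _ _ (begin
  d + (p + f + k + 3 + e)      ≡⟨ rearrange d p f k e ⟩
  suc p + (d + f) + k + 2 + e  ≡⟨ eq ⟩
  d + (d + 0)                  ≡⟨ cong (d +_) (+-identityʳ d) ⟩
  d + d                        ∎))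
  where
  open ≡-Reasoning
  rearrange : ∀ d p f k e → d + (p + f + k + 3 + e) ≡ suc p + (d + f) + k + 2 + e
  rearrange = solve-∀

-- With d = p + f + k + 3 + e, the lower bound (y + r + 1) d on the degree sum
-- exceeds the upper bound y (y + k) + r (d + 1) + 1 by p f + 2p + e + p e + 1.
degree-sum-excess : ∀ p f k e → let d = p + f + k + 3 + e in
  suc (suc p + (d + f)) * d ≡ suc p * (suc p + k) + ((d + f) * (d + 1) + 1) + suc (p * f + 2 * p + e + p * e)
degree-sum-excess = solve-∀

deficiency-arithmetic : ∀ d k y r w → y + r + k + 2 ≤ 2 * d → w < y → d ≤ r
  → suc (y + r) * d ≤ y * (w + (k + 1)) + (r * (d + 1) + 1) → ⊥
deficiency-arithmetic d k (suc p) r w room (s≤s w≤p) d≤r counted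
  with f , refl ← m≤n⇒∃[o]m+o≡n d≤r
  with e , slack ← m≤n⇒∃[o]m+o≡n room
  with refl ← solve-for-d d p f k e slack
  = m+1+n≰m _ (≤-trans (≤-reflexive (sym (degree-sum-excess p f k e)))
      (≤-trans counted (+-monoˡ-≤ _ (*-monoʳ-≤ (suc p) w+k+1≤y+k))))
  where
  w+k+1≤y+k : w + (k + 1) ≤ suc p + k
  w+k+1≤y+k = subst (_≤ suc p + k) (sym (trans (cong (w +_) (+-comm k 1)) (+-suc w k))) (s≤s (+-monoˡ-≤ k w≤p))

-- G has parts S = Fin s and U = Fin (s + 1); P ⊆ S and Q ⊆ U are the
-- surviving vertices, |P| = |Q| and k + 1 vertices of U were deleted.
module Deficiency {s : ℕ} (G : BipGraph s (suc s)) (d k : ℕ)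
  (room : s + k + 2 ≤ 2 * d)
  (degU≥ : ∀ u → d ≤ degU G u)
  (degS≤ : ∀ i → degS G i ≤ d + 2)
  (max-unique : ∀ i j → degS G i ≡ d + 2 → degS G j ≡ d + 2 → i ≡ j)
  (P : Sub s) (Q : Sub (suc s)) (|P|≡|Q| : count P ≡ count Q) (|∁Q| : count (∁ Q) ≡ k + 1)
  where

  open Hall G
  open ≤-Reasoning

  isMax : Sub s
  isMax i = does (degS G i ≟ d + 2)

  at-most-one-max : count isMax ≤ 1
  at-most-one-max = count-≤1 isMax
    (λ i j mi mj → max-unique i j (does-true (degS G i ≟ d + 2) mi) (does-true (degS G j ≟ d + 2) mj))

  degree-outside : ∀ i → degS G i ≤ (d + 1) + indicator (isMax i)
  degree-outside i with degS G i ≟ d + 2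
  ... | yes ≡d+2 rewrite dec-true (degS G i ≟ d + 2) ≡d+2 =
    ≤-trans (degS≤ i) (≤-reflexive (sym (+-assoc d 1 1)))
  ... | no  ≢d+2 rewrite dec-false (degS G i ≟ d + 2) ≢d+2 =
    ≤-trans (≤-pred (≤-trans (≤∧≢⇒< (degS≤ i) ≢d+2) (≤-reflexive (+-suc d 1)))) (m≤m+n (d + 1) 0)

  -- A vertex of X has all neighbours in N(X), and N(X) ∖ Q has at most k + 1 elements.
  degree-inside : ∀ X i → X i ≡ true → degS G i ≤ count (N X ∩ Q) + (k + 1)
  degree-inside X i x = begin
    degS G i                             ≤⟨ count-mono (λ u r → N-intro i u x r) ⟩
    count (N X)                          ≡⟨ count-split (N X) Q ⟩
    count (N X ∩ Q) + count (N X ∖ Q)    ≤⟨ +-monoʳ-≤ (count (N X ∩ Q)) (count-mono (∩-⊆ʳ (N X) (∁ Q))) ⟩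
    count (N X ∩ Q) + count (∁ Q)        ≡⟨ cong (count (N X ∩ Q) +_) |∁Q| ⟩
    count (N X ∩ Q) + (k + 1)            ∎

  degree-sum-upper : ∀ X → ∑[ i < s ] degS G i
    ≤ count X * (count (N X ∩ Q) + (k + 1)) + (count (∁ X) * (d + 1) + 1)
  degree-sum-upper X = begin
    ∑[ i < s ] degS G i                                               ≤⟨ ∑-mono bound ⟩
    ∑[ i < s ] ((if X i then c else d + 1) + indicator (isMax i))     ≡⟨ ∑-distrib-+ {s} _ _ ⟩
    ∑[ i < s ] (if X i then c else d + 1) + ∑[ i < s ] indicator (isMax i)
                                                  ≡⟨ cong₂ _+_ (∑-if X c (d + 1)) (sym (count≡∑ isMax)) ⟩
    count X * c + count (∁ X) * (d + 1) + count isMax                 ≤⟨ +-monoʳ-≤ _ at-most-one-max ⟩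
    count X * c + count (∁ X) * (d + 1) + 1                           ≡⟨ +-assoc (count X * c) _ 1 ⟩
    count X * c + (count (∁ X) * (d + 1) + 1)                         ∎
    where
    c : ℕ
    c = count (N X ∩ Q) + (k + 1)
    bound : ∀ i → degS G i ≤ (if X i then c else d + 1) + indicator (isMax i)
    bound i with X i in x
    ... | true  = ≤-trans (degree-inside X i x) (m≤m+n c _)
    ... | false = degree-outside i

  degree-sum-lower : suc s * d ≤ ∑[ i < s ] degS G i
  degree-sum-lower = begin
    suc s * d                  ≡⟨ ∑-const (suc s) d ⟨
    ∑[ u < suc s ] d           ≤⟨ ∑-mono degU≥ ⟩
    ∑[ u < suc s ] degU G u    ≡⟨ handshake G ⟨
    ∑[ i < s ] degS G i        ∎

  -- If X ⊆ P is deficient, some vertex of Q has no neighbour in X; its at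
  -- least d neighbours all lie outside X.
  deficient⇒outside-large : ∀ X → X ⊆ P → count (N X ∩ Q) < count X → d ≤ count (∁ X)
  deficient⇒outside-large X X⊆P deficient with count-witness (Q ∖ N X) Q∖NX≠∅
    where
    Q∩NX<Q : count (Q ∩ N X) + 0 < count (Q ∩ N X) + count (Q ∖ N X)
    Q∩NX<Q = begin-strict
      count (Q ∩ N X) + 0                   ≡⟨ +-identityʳ _ ⟩
      count (Q ∩ N X)                       ≡⟨ count-cong (λ u → ∧-comm (Q u) (N X u)) ⟩
      count (N X ∩ Q)                       <⟨ deficient ⟩
      count X                               ≤⟨ count-mono X⊆P ⟩
      count P                               ≡⟨ |P|≡|Q| ⟩
      count Q                               ≡⟨ count-split Q (N X) ⟩
      count (Q ∩ N X) + count (Q ∖ N X)     ∎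
    Q∖NX≠∅ : 1 ≤ count (Q ∖ N X)
    Q∖NX≠∅ = +-cancelˡ-< (count (Q ∩ N X)) 0 _ Q∩NX<Q
  ... | u , u∈Q∖NX = ≤-trans (degU≥ u) (count-mono (λ i Giu → ∁-intro X i (λ x →
          ∁-elim (N X) u (∩-⊆ʳ Q (∁ (N X)) u u∈Q∖NX) (N-intro i u x Giu))))

  -- No X ⊆ P is deficient: the degree sum of S would exceed its upper bound.
  hall-condition : HallCondition P Q
  hall-condition X X⊆P with count X ≤? count (N X ∩ Q)
  ... | yes enough    = enough
  ... | no  deficient = ⊥-elim (deficiency-arithmetic d k y r w room′ w<y
          (deficient⇒outside-large X X⊆P w<y) counted)
    where
    y r w : ℕ
    y = count X
    r = count (∁ X)
    w = count (N X ∩ Q)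
    w<y : w < y
    w<y = ≰⇒> deficient
    room′ : y + r + k + 2 ≤ 2 * d
    room′ = subst (λ m → m + k + 2 ≤ 2 * d) (sym (count-compl X)) room
    counted : suc (y + r) * d ≤ y * (w + (k + 1)) + (r * (d + 1) + 1)
    counted = subst (λ m → suc m * d ≤ y * (w + (k + 1)) + (r * (d + 1) + 1)) (sym (count-compl X))
                (≤-trans degree-sum-lower (degree-sum-upper X))

∣∣≡count : ∀ {n} (p : Subset n) → ∣ p ∣ ≡ count (lookup p)
∣∣≡count []          = refl
∣∣≡count (true ∷ p)  = cong suc (∣∣≡count p)
∣∣≡count (false ∷ p) = ∣∣≡count p

∉⇒∁ : ∀ {n} (p : Subset n) i → i ∉ p → ∁ (lookup p) i ≡ true
∉⇒∁ p i i∉p = ∁-intro (lookup p) i (λ i∈p → i∉p (lookup⇒[]= i p i∈p))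

∁⇒∉ : ∀ {n} (p : Subset n) i → ∁ (lookup p) i ≡ true → i ∉ p
∁⇒∉ p i h i∈p = ∁-elim (lookup p) i h ([]=⇒lookup i∈p)

count-∁-Subset : ∀ {n} (p : Subset n) → count (∁ (lookup p)) + ∣ p ∣ ≡ n
count-∁-Subset p = trans (+-comm _ ∣ p ∣) (trans (cong (_+ count (∁ (lookup p))) (∣∣≡count p)) (count-compl (lookup p)))

-- P = S ∖ S' and Q = U ∖ U' have equal size and satisfy Hall's condition, so
-- Hall's theorem gives a matching saturating P, which then also saturates Q.
lemma3p1 : (d k s : ℕ) → s + k + 2 ≤ 2 * d → k + 1 ≤ d
    → (G : BipGraph s (suc s))
    → (∀ u → d ≤ degU G u)
    → (∀ i → degS G i ≤ d + 2)
    → (∀ i j → degS G i ≡ d + 2 → degS G j ≡ d + 2 → i ≡ j)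
    → (S' : Subset s) → ∣ S' ∣ ≡ k
    → (U' : Subset (suc s)) → ∣ U' ∣ ≡ k + 1
    → Σ (BipGraph s (suc s)) (λ M → IsPerfectMatchingDel G S' U' M)
lemma3p1 d k s room _ G degU≥ degS≤ max-unique S' |S'| U' |U'| =
  M , (λ i u e → let (r , p , q) = edge i u e in r , ∁⇒∉ S' i p , ∁⇒∉ U' u q)
    , (λ i i∉S' → row i (∉⇒∁ S' i i∉S'))
    , (λ u u∉U' → matching-perfect matching |P|≡|Q| u (∉⇒∁ U' u u∉U'))
  where
  open Hall G
  P : Sub s
  P = ∁ (lookup S')
  Q : Sub (suc s)
  Q = ∁ (lookup U')
  |P|+k : count P + k ≡ s
  |P|+k = subst (λ m → count P + m ≡ s) |S'| (count-∁-Subset S')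
  |Q|+k : count Q + k ≡ s
  |Q|+k = suc-injective (begin
    suc (count Q + k)       ≡⟨ +-suc (count Q) k ⟨
    count Q + suc k         ≡⟨ cong (count Q +_) (+-comm k 1) ⟨
    count Q + (k + 1)       ≡⟨ cong (count Q +_) |U'| ⟨
    count Q + ∣ U' ∣        ≡⟨ count-∁-Subset U' ⟩
    suc s                   ∎)
    where open ≡-Reasoning
  |P|≡|Q| : count P ≡ count Q
  |P|≡|Q| = +-cancelʳ-≡ k _ _ (trans |P|+k (sym |Q|+k))
  |∁Q| : count (∁ Q) ≡ k + 1
  |∁Q| = trans (count-cong (λ u → not-involutive (lookup U' u))) (trans (sym (∣∣≡count U')) |U'|)
  open Deficiency G d k room degU≥ degS≤ max-unique P Q |P|≡|Q| |∁Q|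
  M : BipGraph s (suc s)
  M = proj₁ (hall P Q hall-condition)
  matching : IsMatching P Q M
  matching = proj₂ (hall P Q hall-condition)
  open IsMatching matching
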